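{- Let $k$ be a positive integer. Let $a(k)$ be the number of permutations $\mu\in S_{k^2}$ that avoid both $12\cdots(k+1)$ and $(k+1)k\cdots1$ and satisfy $\mu=\mathrm{comp}(\mathrm{rev}(\mu))$, and let $a'(k)$ be the number of permutations $\mu\in S_{k^2}$ that avoid both $12\cdots(k+1)$ and $(k+1)k\cdots1$ and satisfy $\mu=\mathrm{rot}(\mu)$. Then \[|\mathrm{SAv}_{k^3}(12\cdots(k+1))|\ge\begin{cases}a(k)^{k/2}, & k \text{ even},\\ a(k)^{(k-1)/2}a'(k), & k\text{ odd}.\end{cases}\]
   Context: Permutations $\pi\in S_n$ are identified with words $\pi(1)\cdots\pi(n)$. For $\tau\in S_m$, entries $\pi(i_1),\ldots,\pi(i_m)$ with $i_1<\cdots<i_m$ form an occurrence of $\tau$ if for all $j,l$, $\pi(i_j)<\pi(i_l)$ iff $\tau(j)<\tau(l)$; $\pi$ avoids $\tau$ if there is no occurrence. $\mathrm{SAv}_n(\tau)$ is the set of $\pi\in S_n$ such that both $\pi$ and $\pi^2=\pi\circ\pi$ avoid $\tau$. For $\pi\in S_n$: $\mathrm{rev}(\pi)=\pi(n)\cdots\pi(1)$; $\mathrm{comp}(\pi)=(n+1-\pi(1))\cdots(n+1-\pi(n))$; $\mathrm{rot}(\pi)=\mathrm{rev}(\pi^{ -1})$ (the permutation whose plot is the plot of $\pi$ rotated $90^\circ$ counterclockwise). -}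

module Defs where

open import Data.Bool using (Bool; true; false; _∧_; _∨_; not; if_then_else_)
open import Data.Nat using (ℕ; zero; suc; _+_; _∸_; _≡ᵇ_; _<ᵇ_)
open import Data.List using (List; []; _∷_; length; map; reverse; filterᵇ; concatMap; applyUpTo)
open import Data.Bool.ListAction using (and; all; any)

-- Words / permutations are represented as lists of naturals, one-line
-- notation π(1) ⋯ π(n) with values in {1,…,n} (1-based, as in the paper).

range : ℕ → List ℕ
range n = applyUpTo suc n

words : List ℕ → ℕ → List (List ℕ)
words xs zero    = [] ∷ []
words xs (suc m) = concatMap (λ x → map (x ∷_) (words xs m)) xs

elemᵇ : ℕ → List ℕ → Bool
elemᵇ x = any (x ≡ᵇ_)

isPerm : ℕ → List ℕ → Bool
isPerm n w = (length w ≡ᵇ n) ∧ all (λ j → elemᵇ j w) (range n)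

S : ℕ → List (List ℕ)
S n = filterᵇ (isPerm n) (words (range n) n)

-- π(i) for 1-based i (0 if out of range)
at : List ℕ → ℕ → ℕ
at []       _             = 0
at (x ∷ xs) zero          = 0
at (x ∷ xs) (suc zero)    = x
at (x ∷ xs) (suc (suc i)) = at xs (suc i)

-- 1-based position of value v in w (0 if absent); gives π⁻¹(v)
pos : ℕ → List ℕ → ℕ
pos v []       = 0
pos v (x ∷ xs) = if v ≡ᵇ x then 1 else (if elemᵇ v xs then suc (pos v xs) else 0)

square : List ℕ → List ℕ
square w = map (at w) w

inv : List ℕ → List ℕ
inv w = map (λ j → pos j w) (range (length w))

rev : List ℕ → List ℕ
rev = reverse

comp : List ℕ → List ℕ
comp w = map (λ v → suc (length w) ∸ v) w

rot : List ℕ → List ℕ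
rot w = rev (inv w)

subseqs : ℕ → List ℕ → List (List ℕ)
subseqs zero    _        = [] ∷ []
subseqs (suc m) []       = []
subseqs (suc m) (x ∷ xs) = map (x ∷_) (subseqs m xs) ++ subseqs (suc m) xs
  where open import Data.List using (_++_)

_⇔ᵇ_ : Bool → Bool → Bool
a ⇔ᵇ b = (a ∧ b) ∨ (not a ∧ not b)

pairs : List ℕ → List ℕ → List (Bool)
pairs xs ts = concatMap (λ j → map (λ l → (at xs j <ᵇ at xs l) ⇔ᵇ (at ts j <ᵇ at ts l))
                                     (range (length ts)))
                        (range (length ts))

orderIsoᵇ : List ℕ → List ℕ → Bool
orderIsoᵇ xs τ = (length xs ≡ᵇ length τ) ∧ and (pairs xs τ)

containsᵇ : List ℕ → List ℕ → Bool
containsᵇ π τ = any (λ xs → orderIsoᵇ xs τ) (subseqs (length τ) π)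

avoidsᵇ : List ℕ → List ℕ → Bool
avoidsᵇ π τ = not (containsᵇ π τ)

SAv : ℕ → List ℕ → List (List ℕ)
SAv n τ = filterᵇ (λ π → avoidsᵇ π τ ∧ avoidsᵇ (square π) τ) (S n)

incr : ℕ → List ℕ
incr m = range m

decr : ℕ → List ℕ
decr m = reverse (range m)

_≡ʷ_ : List ℕ → List ℕ → Bool
[]       ≡ʷ []       = true
(x ∷ xs) ≡ʷ (y ∷ ys) = (x ≡ᵇ y) ∧ (xs ≡ʷ ys)
_        ≡ʷ _        = false

a : ℕ → ℕ
a k = length (filterᵇ (λ μ → avoidsᵇ μ (incr (suc k)) ∧ avoidsᵇ μ (decr (suc k))
                               ∧ (μ ≡ʷ comp (rev μ)))
                      (S (k * k)))
  where open import Data.Nat using (_*_)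

a′ : ℕ → ℕ
a′ k = length (filterᵇ (λ μ → avoidsᵇ μ (incr (suc k)) ∧ avoidsᵇ μ (decr (suc k))
                                ∧ (μ ≡ʷ rot μ))
                       (S (k * k)))
  where open import Data.Nat using (_*_)

module Submission where

-- Write m = k². A permutation of size k³ is built as the skew sum of k blocks b₀, …, b_{k-1},
-- each a permutation of size m avoiding 12⋯(k+1); the skew sum then avoids 12⋯(k+1) as well.
-- It sends the t-th block onto the positions of the mirror block k-1-t, so its square is, block
-- by block, b_{k-1-t} ∘ b_t shifted; if all these composites are decreasing, the square is a
-- concatenation of k decreasing runs and avoids 12⋯(k+1) too. This holds for the palindrome
-- μ₁, …, μ_j, (c), compInv μ_j, …, compInv μ₁ with compInv μ = comp(μ⁻¹): compInv μ ∘ μ is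
-- always the reversal, μ ∘ compInv μ is the reversal when μ = comp(rev μ), and c ∘ c is the
-- reversal when c = rot c. Finally compInv μ avoids 12⋯(k+1) because μ avoids (k+1)⋯1, and
-- distinct choices of (μ₁, …, μ_j, c) give distinct permutations.

open import Defs
open import Data.Bool using (Bool; false; true; T; not; _∧_)
open import Data.Bool.Properties using (T?; T-∧; T-≡; T-not-≡; ∧-assoc)
open import Data.Bool.ListAction using (and; all)
open import Data.Empty using (⊥-elim)
open import Data.Nat using (ℕ; zero; suc; _+_; _*_; _∸_; _^_; _≤_; _<_; _≥_; _>_; _≤?_; z≤n; s≤s; z<s; s<s⁻¹; _≡ᵇ_; _<ᵇ_)
open import Data.Nat.Properties
open import Data.List using (List; []; _∷_; [_]; _++_; length; map; reverse; concat; concatMap; applyUpTo; filterᵇ; cartesianProductWith; cartesianProduct)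
open import Data.List.Properties using (length-map; length-++; length-++-sucʳ; length-reverse; length-applyUpTo; map-∘; map-id; map-cong-local; map-injective; concat-map; unfold-reverse; ++-identityʳ; ∷-injective; ∷ʳ-injective)
open import Data.List.Membership.Propositional using (_∈_; _∉_; find; lose)
open import Data.List.Membership.Propositional.Properties using (∈-∃++; ∈-++⁺ˡ; ∈-++⁺ʳ; ∈-++⁻; ∈-map⁺; ∈-map⁻; ∈-filter⁺; ∈-filter⁻; ∈-applyUpTo⁺; ∈-applyUpTo⁻; ∈-cartesianProductWith⁺; ∈-cartesianProductWith⁻; ∈-cartesianProduct⁻)
open import Data.List.Relation.Binary.Sublist.Propositional using (_⊆_; []; _∷_; _∷ʳ_; minimum; ⊆-refl)
open import Data.List.Relation.Binary.Sublist.Propositional.Properties as Sublist using (All-resp-⊆)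
open import Data.List.Relation.Unary.Any as Any using (here; there)
open import Data.List.Relation.Unary.Any.Properties using (any⁺; any⁻; reverse⁻)
open import Data.List.Relation.Unary.All as All using (All; []; _∷_)
import Data.List.Relation.Unary.All.Properties as All
open import Data.List.Relation.Unary.AllPairs as AllPairs using (AllPairs; []; _∷_)
import Data.List.Relation.Unary.AllPairs.Properties as AllPairs
open import Data.List.Relation.Unary.Unique.Propositional using (Unique)
import Data.List.Relation.Unary.Unique.Propositional.Properties as Unique
open import Data.Product using (∃; _×_; _,_; proj₁; proj₂)
open import Data.Sum using (_⊎_; inj₁; inj₂; [_,_]′; map₂)
open import Function using (_∘_; _⇔_; mk⇔; Equivalence)
open import Relation.Nullary using (¬_; yes; no; contradiction)
open import Relation.Binary.Definitions using (tri<; tri≈; tri>)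
open import Relation.Binary.PropositionalEquality using (_≡_; _≢_; refl; sym; trans; cong; cong₂; subst; module ≡-Reasoning)

open Equivalence using (to; from)

T-ext : ∀ {a b} → (T a → T b) → (T b → T a) → a ≡ b
T-ext {false} {false} _ _ = refl
T-ext {false} {true}  _ g = ⊥-elim (g _)
T-ext {true}  {false} f _ = ⊥-elim (f _)
T-ext {true}  {true}  _ _ = refl

T-⇔ᵇ : ∀ {a b} → T (a ⇔ᵇ b) ⇔ (a ≡ b)
T-⇔ᵇ {a} {b} = mk⇔ (to-≡ a b) (λ { refl → refl-⇔ᵇ a })
  where
  to-≡ : ∀ a b → T (a ⇔ᵇ b) → a ≡ b
  to-≡ false false _ = refl
  to-≡ true  true  _ = refl
  refl-⇔ᵇ : ∀ a → T (a ⇔ᵇ a)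
  refl-⇔ᵇ false = _
  refl-⇔ᵇ true  = _

T-not : ∀ {b} → T (not b) ⇔ (¬ T b)
T-not {false} = mk⇔ (λ _ ()) (λ _ → _)
T-not {true}  = mk⇔ (λ ())   (λ ¬⊤ → ¬⊤ _)

T-≡ᵇ : ∀ {m n} → T (m ≡ᵇ n) ⇔ (m ≡ n)
T-≡ᵇ {m} {n} = mk⇔ (≡ᵇ⇒≡ m n) (≡⇒≡ᵇ m n)

<ᵇ-cong : ∀ {m n i j} → (m < n → i < j) → (i < j → m < n) → (m <ᵇ n) ≡ (i <ᵇ j)
<ᵇ-cong {m} {n} {i} {j} f g = T-ext (<⇒<ᵇ ∘ f ∘ <ᵇ⇒< m n) (<⇒<ᵇ ∘ g ∘ <ᵇ⇒< i j)

T-elemᵇ : ∀ {x xs} → T (elemᵇ x xs) ⇔ (x ∈ xs)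
T-elemᵇ {x} {xs} = mk⇔ (Any.map (≡ᵇ⇒≡ x _) ∘ any⁻ (x ≡ᵇ_) xs)
                       (any⁺ (x ≡ᵇ_) ∘ Any.map (≡⇒≡ᵇ x _))

≡ʷ⇒≡ : ∀ xs ys → T (xs ≡ʷ ys) → xs ≡ ys
≡ʷ⇒≡ []       []       _ = refl
≡ʷ⇒≡ (x ∷ xs) (y ∷ ys) e =
  let x≡y , xs≡ys = to T-∧ e in cong₂ _∷_ (≡ᵇ⇒≡ x y x≡y) (≡ʷ⇒≡ xs ys xs≡ys)

and-++ : ∀ xs ys → and (xs ++ ys) ≡ and xs ∧ and ys
and-++ []       ys = refl
and-++ (x ∷ xs) ys = trans (cong (x ∧_) (and-++ xs ys)) (sym (∧-assoc x (and xs) (and ys)))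

and-concatMap : ∀ {A : Set} (f : A → List Bool) xs → and (concatMap f xs) ≡ all (and ∘ f) xs
and-concatMap f []       = refl
and-concatMap f (x ∷ xs) = trans (and-++ (f x) (concatMap f xs)) (cong (and (f x) ∧_) (and-concatMap f xs))

T-all : ∀ {A : Set} (p : A → Bool) xs → T (all p xs) ⇔ All (T ∘ p) xs
T-all p xs = mk⇔ (All.all⁺ p xs) (All.all⁻ p)

-- Lists read by position; in the lemmas, at xs (suc i) is the entry of index i.

InRange : ℕ → ℕ → Set
InRange n v = 1 ≤ v × v ≤ n

at-∈ : ∀ xs {i} → i < length xs → at xs (suc i) ∈ xs
at-∈ (x ∷ xs) {zero}  _         = here refl
at-∈ (x ∷ xs) {suc i} (s≤s i<n) = there (at-∈ xs i<n)

at-∈₁ : ∀ xs {v} → InRange (length xs) v → at xs v ∈ xs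
at-∈₁ xs {suc i} (_ , i<n) = at-∈ xs i<n

at-map : ∀ (f : ℕ → ℕ) xs {i} → i < length xs → at (map f xs) (suc i) ≡ f (at xs (suc i))
at-map f (x ∷ xs) {zero}  _         = refl
at-map f (x ∷ xs) {suc i} (s≤s i<n) = at-map f xs i<n

at-++ˡ : ∀ xs ys {i} → i < length xs → at (xs ++ ys) (suc i) ≡ at xs (suc i)
at-++ˡ (x ∷ xs) ys {zero}  _         = refl
at-++ˡ (x ∷ xs) ys {suc i} (s≤s i<n) = at-++ˡ xs ys i<n

at-++ʳ : ∀ xs ys i → at (xs ++ ys) (suc (length xs + i)) ≡ at ys (suc i)
at-++ʳ []       ys i = refl
at-++ʳ (x ∷ xs) ys i = at-++ʳ xs ys i

at-applyUpTo : ∀ (f : ℕ → ℕ) n {i} → i < n → at (applyUpTo f n) (suc i) ≡ f i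
at-applyUpTo f (suc n) {zero}  _         = refl
at-applyUpTo f (suc n) {suc i} (s≤s i<n) = at-applyUpTo (f ∘ suc) n i<n

applyUpTo-at : ∀ xs → applyUpTo (λ i → at xs (suc i)) (length xs) ≡ xs
applyUpTo-at []       = refl
applyUpTo-at (x ∷ xs) = cong (x ∷_) (applyUpTo-at xs)

mirror-< : ∀ {m x} → x < m → m ∸ suc x < m
mirror-< {suc m} {x} _ = s≤s (m∸n≤m m x)

mirror-involutive : ∀ {m x} → x < m → m ∸ suc (m ∸ suc x) ≡ x
mirror-involutive {suc m} (s≤s x≤m) = m∸[m∸n]≡n x≤m

suc-mirror : ∀ {m x} → x < m → suc (m ∸ suc x) ≡ m ∸ x
suc-mirror x<m = sym (+-∸-assoc 1 x<m)

at-reverse : ∀ xs {i} → i < length xs → at (reverse xs) (suc i) ≡ at xs (suc (length xs ∸ suc i))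
at-reverse (x ∷ xs) {i} i≤n rewrite unfold-reverse x xs with <-cmp i (length xs)
... | tri< i<n _ _ = begin
  at (reverse xs ++ [ x ]) (suc i)        ≡⟨ at-++ˡ (reverse xs) [ x ] (subst (i <_) (sym (length-reverse xs)) i<n) ⟩
  at (reverse xs) (suc i)                 ≡⟨ at-reverse xs i<n ⟩
  at xs (suc (length xs ∸ suc i))         ≡⟨ cong (at (x ∷ xs) ∘ suc) (suc-mirror i<n) ⟩
  at (x ∷ xs) (suc (length xs ∸ i))       ∎
  where open ≡-Reasoning
... | tri≈ _ refl _ = begin
  at (reverse xs ++ [ x ]) (suc i)                         ≡⟨ cong (λ n → at (reverse xs ++ [ x ]) (suc n)) (trans (+-identityʳ _) (length-reverse xs)) ⟨
  at (reverse xs ++ [ x ]) (suc (length (reverse xs) + 0)) ≡⟨ at-++ʳ (reverse xs) [ x ] 0 ⟩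
  x                                                        ≡⟨ cong (at (x ∷ xs) ∘ suc) (n∸n≡0 i) ⟨
  at (x ∷ xs) (suc (i ∸ i))                                ∎
  where open ≡-Reasoning
... | tri> _ _ i>n = contradiction i≤n (<⇒≱ (s≤s i>n))

AllPairs-at : ∀ {R : ℕ → ℕ → Set} {xs} → AllPairs R xs →
  ∀ {i j} → i < j → j < length xs → R (at xs (suc i)) (at xs (suc j))
AllPairs-at {xs = x ∷ xs} (px ∷ _)  {zero}  {suc j} _         (s≤s j<n) = All.lookup px (at-∈ xs j<n)
AllPairs-at {xs = x ∷ xs} (_  ∷ ps) {suc i} {suc j} (s≤s i<j) (s≤s j<n) = AllPairs-at ps i<j j<n

AllPairs-at⁺ : ∀ {R : ℕ → ℕ → Set} xs →
  (∀ {i j} → i < j → j < length xs → R (at xs (suc i)) (at xs (suc j))) → AllPairs R xs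
AllPairs-at⁺ {R} xs h = subst (AllPairs R) (applyUpTo-at xs) (AllPairs.applyUpTo⁺₁ _ (length xs) h)

All-at⁺ : ∀ {P : ℕ → Set} xs → (∀ {i} → i < length xs → P (at xs (suc i))) → All P xs
All-at⁺ {P} xs h = subst (All P) (applyUpTo-at xs) (All.applyUpTo⁺₁ _ (length xs) h)

All-reverse : ∀ {P : ℕ → Set} {xs} → All P xs → All P (reverse xs)
All-reverse pxs = All.tabulate (All.lookup pxs ∘ reverse⁻)

AllPairs-reverse : ∀ {R : ℕ → ℕ → Set} {xs} → AllPairs R xs → AllPairs (λ a b → R b a) (reverse xs)
AllPairs-reverse [] = []
AllPairs-reverse {xs = x ∷ xs} (px ∷ pxs) rewrite unfold-reverse x xs =
  AllPairs.++⁺ (AllPairs-reverse pxs) ([] ∷ []) (All.map (_∷ []) (All-reverse px))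

All-range : ∀ {P : ℕ → Set} n → All P (range n) ⇔ (∀ {i} → i < n → P (suc i))
All-range n = mk⇔ (All.applyUpTo⁻ suc n) (All.applyUpTo⁺₁ suc n)

range-increasing : ∀ n → AllPairs _<_ (range n)
range-increasing n = AllPairs.applyUpTo⁺₁ suc n (λ i<j _ → s≤s i<j)

∈-range : ∀ {n v} → v ∈ range n ⇔ InRange n v
∈-range {n} = mk⇔ to′ from′
  where
  to′ : ∀ {v} → v ∈ range n → InRange n v
  to′ v∈ with ∈-applyUpTo⁻ suc v∈
  ... | i , i<n , refl = s≤s z≤n , i<n
  from′ : ∀ {v} → InRange n v → v ∈ range n
  from′ {suc v} (_ , v<n) = ∈-applyUpTo⁺ suc v<n

SameOrder : List ℕ → List ℕ → Set
SameOrder xs τ = ∀ {i j} → i < length τ → j < length τ →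
  (at xs (suc i) <ᵇ at xs (suc j)) ≡ (at τ (suc i) <ᵇ at τ (suc j))

T-and-pairs : ∀ xs τ → T (and (pairs xs τ)) ⇔ SameOrder xs τ
T-and-pairs xs τ = mk⇔ to′ from′
  where
  n : ℕ
  n = length τ
  agree : ℕ → ℕ → Bool
  agree j l = (at xs j <ᵇ at xs l) ⇔ᵇ (at τ j <ᵇ at τ l)
  unfold : and (pairs xs τ) ≡ all (λ j → all (agree j) (range n)) (range n)
  unfold = and-concatMap (λ j → map (agree j) (range n)) (range n)
  to′ : T (and (pairs xs τ)) → SameOrder xs τ
  to′ h i<n j<n = to T-⇔ᵇ (to (All-range n) (to (T-all _ (range n)) (to (All-range n) (to (T-all _ (range n)) (subst T unfold h)) i<n)) j<n)
  from′ : SameOrder xs τ → T (and (pairs xs τ))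
  from′ h = subst T (sym unfold) (from (T-all _ (range n)) (from (All-range n) λ i<n →
              from (T-all _ (range n)) (from (All-range n) λ j<n → from T-⇔ᵇ (h i<n j<n))))

T-orderIsoᵇ : ∀ xs τ → T (orderIsoᵇ xs τ) ⇔ (length xs ≡ length τ × SameOrder xs τ)
T-orderIsoᵇ xs τ = mk⇔ to′ from′
  where
  to′ : T (orderIsoᵇ xs τ) → length xs ≡ length τ × SameOrder xs τ
  to′ h = let l , p = to T-∧ h in to T-≡ᵇ l , to (T-and-pairs xs τ) p
  from′ : length xs ≡ length τ × SameOrder xs τ → T (orderIsoᵇ xs τ)
  from′ (l , p) = from T-∧ (from T-≡ᵇ l , from (T-and-pairs xs τ) (λ {i} {j} → p {i} {j}))

<ᵇ-at-increasing : ∀ {xs} → AllPairs _<_ xs → ∀ {i j} → i < length xs → j < length xs →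
  (at xs (suc i) <ᵇ at xs (suc j)) ≡ (i <ᵇ j)
<ᵇ-at-increasing {xs} ap {i} {j} i<n j<n = <ᵇ-cong reflect (λ i<j → AllPairs-at ap i<j j<n)
  where
  reflect : at xs (suc i) < at xs (suc j) → i < j
  reflect x<y with <-cmp i j
  ... | tri< i<j _ _  = i<j
  ... | tri≈ _ refl _ = contradiction x<y (<-irrefl refl)
  ... | tri> _ _ j<i  = contradiction x<y (<-asym (AllPairs-at ap j<i i<n))

<ᵇ-at-decreasing : ∀ {xs} → AllPairs _>_ xs → ∀ {i j} → i < length xs → j < length xs →
  (at xs (suc i) <ᵇ at xs (suc j)) ≡ (j <ᵇ i)
<ᵇ-at-decreasing {xs} ap {i} {j} i<n j<n = <ᵇ-cong reflect (λ j<i → AllPairs-at ap j<i i<n)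
  where
  reflect : at xs (suc i) < at xs (suc j) → j < i
  reflect x<y with <-cmp j i
  ... | tri< j<i _ _  = j<i
  ... | tri≈ _ refl _ = contradiction x<y (<-irrefl refl)
  ... | tri> _ _ i<j  = contradiction x<y (<-asym (AllPairs-at ap i<j j<n))

length-incr : ∀ r → length (incr r) ≡ r
length-incr = length-applyUpTo suc

length-decr : ∀ r → length (decr r) ≡ r
length-decr r = trans (length-reverse (range r)) (length-incr r)

orderIso-incr⁻ : ∀ {ys r} → T (orderIsoᵇ ys (incr r)) → length ys ≡ r × AllPairs _<_ ys
orderIso-incr⁻ {ys} {r} h = ys≡r , AllPairs-at⁺ ys increasing
  where
  ys≡r : length ys ≡ r
  ys≡r = trans (proj₁ (to (T-orderIsoᵇ ys (incr r)) h)) (length-incr r)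
  increasing : ∀ {i j} → i < j → j < length ys → at ys (suc i) < at ys (suc j)
  increasing {i} {j} i<j j<n = <ᵇ⇒< _ _ (subst T (sym agree) (<⇒<ᵇ i<j))
    where
    bound : ∀ {l} → l < length ys → l < length (incr r)
    bound = subst (_ <_) (trans ys≡r (sym (length-incr r)))
    agree : (at ys (suc i) <ᵇ at ys (suc j)) ≡ (i <ᵇ j)
    agree = trans (proj₂ (to (T-orderIsoᵇ ys (incr r)) h) (bound (<-trans i<j j<n)) (bound j<n))
                  (<ᵇ-at-increasing (range-increasing r) (bound (<-trans i<j j<n)) (bound j<n))

orderIso-incr⁺ : ∀ {ys r} → length ys ≡ r → AllPairs _<_ ys → T (orderIsoᵇ ys (incr r))
orderIso-incr⁺ {ys} {r} ys≡r ap = from (T-orderIsoᵇ ys (incr r)) (ys≡τ , same)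
  where
  ys≡τ : length ys ≡ length (incr r)
  ys≡τ = trans ys≡r (sym (length-incr r))
  same : SameOrder ys (incr r)
  same i<n j<n = trans (<ᵇ-at-increasing ap (subst (_ <_) (sym ys≡τ) i<n) (subst (_ <_) (sym ys≡τ) j<n))
                       (sym (<ᵇ-at-increasing (range-increasing r) i<n j<n))

orderIso-decr⁺ : ∀ {ys r} → length ys ≡ r → AllPairs _>_ ys → T (orderIsoᵇ ys (decr r))
orderIso-decr⁺ {ys} {r} ys≡r ap = from (T-orderIsoᵇ ys (decr r)) (ys≡τ , same)
  where
  ys≡τ : length ys ≡ length (decr r)
  ys≡τ = trans ys≡r (sym (length-decr r))
  same : SameOrder ys (decr r)
  same i<n j<n = trans (<ᵇ-at-decreasing ap (subst (_ <_) (sym ys≡τ) i<n) (subst (_ <_) (sym ys≡τ) j<n))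
                       (sym (<ᵇ-at-decreasing (AllPairs-reverse (range-increasing r)) i<n j<n))

∈-subseqs⁻ : ∀ r xs {ys} → ys ∈ subseqs r xs → ys ⊆ xs × length ys ≡ r
∈-subseqs⁻ zero    xs       (here refl) = minimum xs , refl
∈-subseqs⁻ (suc r) (x ∷ xs) ys∈ with ∈-++⁻ (map (x ∷_) (subseqs r xs)) ys∈
... | inj₁ ys∈ˡ with ∈-map⁻ (x ∷_) ys∈ˡ
...   | zs , zs∈ , refl = let zs⊆ , zs≡r = ∈-subseqs⁻ r xs zs∈ in refl ∷ zs⊆ , cong suc zs≡r
∈-subseqs⁻ (suc r) (x ∷ xs) ys∈ | inj₂ ys∈ʳ = let ys⊆ , ys≡r = ∈-subseqs⁻ (suc r) xs ys∈ʳ in x ∷ʳ ys⊆ , ys≡r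

∈-subseqs⁺ : ∀ {ys xs} → ys ⊆ xs → ys ∈ subseqs (length ys) xs
∈-subseqs⁺ []                        = here refl
∈-subseqs⁺ {[]}     (y ∷ʳ _)         = here refl
∈-subseqs⁺ {z ∷ zs} (y ∷ʳ ys⊆)       = ∈-++⁺ʳ (map (y ∷_) (subseqs (length zs) _)) (∈-subseqs⁺ ys⊆)
∈-subseqs⁺ {x ∷ ys} (refl ∷ ys⊆)     = ∈-++⁺ˡ (∈-map⁺ (x ∷_) (∈-subseqs⁺ ys⊆))

HasChain : (ℕ → ℕ → Set) → ℕ → List ℕ → Set
HasChain R r xs = ∃ λ ys → ys ⊆ xs × length ys ≡ r × AllPairs R ys

contains⇒chain-incr : ∀ π r → T (containsᵇ π (incr r)) → HasChain _<_ r π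
contains⇒chain-incr π r h with find (any⁻ _ (subseqs (length (incr r)) π) h)
... | ys , ys∈ , iso = ys , proj₁ (∈-subseqs⁻ (length (incr r)) π ys∈) , orderIso-incr⁻ iso

chain⇒contains : ∀ {R} π τ → (∀ {ys} → length ys ≡ length τ → AllPairs R ys → T (orderIsoᵇ ys τ)) →
  HasChain R (length τ) π → T (containsᵇ π τ)
chain⇒contains π τ iso (ys , ys⊆ , ys≡τ , ap) =
  any⁺ _ (lose (subst (λ n → ys ∈ subseqs n π) ys≡τ (∈-subseqs⁺ ys⊆)) (iso ys≡τ ap))

avoids-incr⁻ : ∀ π r → T (avoidsᵇ π (incr r)) → ¬ HasChain _<_ r π
avoids-incr⁻ π r h (ys , ys⊆ , ys≡r , ap) =
  to T-not h (chain⇒contains π (incr r) (λ l → orderIso-incr⁺ (trans l (length-incr r)))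
                               (ys , ys⊆ , trans ys≡r (sym (length-incr r)) , ap))

avoids-decr⁻ : ∀ π r → T (avoidsᵇ π (decr r)) → ¬ HasChain _>_ r π
avoids-decr⁻ π r h (ys , ys⊆ , ys≡r , ap) =
  to T-not h (chain⇒contains π (decr r) (λ l → orderIso-decr⁺ (trans l (length-decr r)))
                               (ys , ys⊆ , trans ys≡r (sym (length-decr r)) , ap))

avoids-incr⁺ : ∀ π r → ¬ HasChain _<_ r π → T (avoidsᵇ π (incr r))
avoids-incr⁺ π r noChain = from T-not (noChain ∘ contains⇒chain-incr π r)

module _ {A : Set} where

  ⊆-++⁻ : ∀ (xs : List A) {zs ys} → ys ⊆ xs ++ zs →
    ∃ λ ys₁ → ∃ λ ys₂ → ys ≡ ys₁ ++ ys₂ × ys₁ ⊆ xs × ys₂ ⊆ zs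
  ⊆-++⁻ []       {ys = ys} ys⊆ = [] , ys , refl , [] , ys⊆
  ⊆-++⁻ (x ∷ xs) (.x ∷ʳ ys⊆) with ⊆-++⁻ xs ys⊆
  ... | ys₁ , ys₂ , refl , ys₁⊆ , ys₂⊆ = ys₁ , ys₂ , refl , x ∷ʳ ys₁⊆ , ys₂⊆
  ⊆-++⁻ (x ∷ xs) (refl ∷ ys⊆) with ⊆-++⁻ xs ys⊆
  ... | ys₁ , ys₂ , refl , ys₁⊆ , ys₂⊆ = x ∷ ys₁ , ys₂ , refl , refl ∷ ys₁⊆ , ys₂⊆

  AllPairs-resp-⊆ : ∀ {R : A → A → Set} {xs ys} → AllPairs R xs → ys ⊆ xs → AllPairs R ys
  AllPairs-resp-⊆ []         []           = []
  AllPairs-resp-⊆ (_  ∷ pxs) (_ ∷ʳ ys⊆)   = AllPairs-resp-⊆ pxs ys⊆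
  AllPairs-resp-⊆ (px ∷ pxs) (refl ∷ ys⊆) = All-resp-⊆ ys⊆ px ∷ AllPairs-resp-⊆ pxs ys⊆

  ⊆-map⁻ : ∀ {B : Set} (f : A → B) xs {ys} → ys ⊆ map f xs → ∃ λ zs → zs ⊆ xs × ys ≡ map f zs
  ⊆-map⁻ f []       []           = [] , [] , refl
  ⊆-map⁻ f (x ∷ xs) (_ ∷ʳ ys⊆)   with ⊆-map⁻ f xs ys⊆
  ... | zs , zs⊆ , refl = zs , x ∷ʳ zs⊆ , refl
  ⊆-map⁻ f (x ∷ xs) (refl ∷ ys⊆) with ⊆-map⁻ f xs ys⊆
  ... | zs , zs⊆ , refl = x ∷ zs , refl ∷ zs⊆ , refl

chain-++ : ∀ c xs zs r → All (c <_) xs → All (_≤ c) zs →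
  HasChain _<_ r (xs ++ zs) → HasChain _<_ r xs ⊎ HasChain _<_ r zs
chain-++ c xs zs r above below (ys , ys⊆ , ys≡r , ap) with ⊆-++⁻ xs ys⊆
... | [] , ys₂ , refl , _ , ys₂⊆ = inj₂ (ys₂ , ys₂⊆ , ys≡r , ap)
... | ys₁ , [] , refl , ys₁⊆ , _ rewrite ++-identityʳ ys₁ = inj₁ (ys₁ , ys₁⊆ , ys≡r , ap)
... | a ∷ as , b ∷ bs , refl , a∷as⊆ , b∷bs⊆ = contradiction c<c (<-irrefl refl)
  where
  open ≤-Reasoning
  c<c : c < c
  c<c = begin-strict
    c <⟨ All.head (All-resp-⊆ a∷as⊆ above) ⟩
    a <⟨ All.head (All.++⁻ʳ as (AllPairs.head ap)) ⟩
    b ≤⟨ All.head (All-resp-⊆ b∷bs⊆ below) ⟩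
    c ∎

chain-shift : ∀ c xs r → HasChain _<_ r (map (_+ c) xs) → HasChain _<_ r xs
chain-shift c xs r (ys , ys⊆ , ys≡r , ap) with ⊆-map⁻ (_+ c) xs ys⊆
... | zs , zs⊆ , refl = zs , zs⊆ , trans (sym (length-map (_+ c) zs)) ys≡r ,
                        AllPairs.map (+-cancelʳ-< c _ _) (AllPairs.map⁻ ap)

increasing-in-runs : ∀ runs → All (AllPairs _≥_) runs → ∀ {ys} → ys ⊆ concat runs → AllPairs _<_ ys →
  length ys ≤ length runs
increasing-in-runs []           []           []  _  = z≤n
increasing-in-runs (run ∷ runs) (nonInc ∷ h) ys⊆ ap with ⊆-++⁻ run ys⊆
... | ys₁ , ys₂ , refl , ys₁⊆ , ys₂⊆ = begin
  length (ys₁ ++ ys₂)        ≡⟨ length-++ ys₁ ⟩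
  length ys₁ + length ys₂    ≤⟨ +-mono-≤ (atMostOne (AllPairs-resp-⊆ nonInc ys₁⊆) (AllPairs-resp-⊆ ap (Sublist.++⁺ʳ ys₂ ⊆-refl)))
                                         (increasing-in-runs runs h ys₂⊆ (AllPairs-resp-⊆ ap (Sublist.++⁺ˡ ys₁ ⊆-refl))) ⟩
  1 + length runs            ∎
  where
  open ≤-Reasoning
  atMostOne : ∀ {zs} → AllPairs _≥_ zs → AllPairs _<_ zs → length zs ≤ 1
  atMostOne {[]}         _                 _                 = z≤n
  atMostOne {z ∷ []}     _                 _                 = s≤s z≤n
  atMostOne {z ∷ w ∷ zs} ((z≥w ∷ _) ∷ _) ((z<w ∷ _) ∷ _) = contradiction z<w (≤⇒≯ z≥w)

-- Counting distinct elements

module _ {A : Set} where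

  private
    ∈-remove : ∀ {z x : A} as bs → z ∈ as ++ x ∷ bs → z ≢ x → z ∈ as ++ bs
    ∈-remove []       bs (here z≡x) z≢x = contradiction z≡x z≢x
    ∈-remove []       bs (there z∈) _   = z∈
    ∈-remove (a ∷ as) bs (here z≡a) _   = here z≡a
    ∈-remove (a ∷ as) bs (there z∈) z≢x = there (∈-remove as bs z∈ z≢x)

    ∈-insert⁻ : ∀ {z x : A} as bs → z ∈ as ++ x ∷ bs → z ≡ x ⊎ z ∈ as ++ bs
    ∈-insert⁻ []       bs (here z≡x) = inj₁ z≡x
    ∈-insert⁻ []       bs (there z∈) = inj₂ z∈
    ∈-insert⁻ (a ∷ as) bs (here z≡a) = inj₂ (here z≡a)
    ∈-insert⁻ (a ∷ as) bs (there z∈) = map₂ there (∈-insert⁻ as bs z∈)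

    unique-insert : ∀ (x : A) as bs → Unique (as ++ bs) → x ∉ as ++ bs → Unique (as ++ x ∷ bs)
    unique-insert x []       bs u         x∉ = All.tabulate (λ x∈ x≡ → x∉ (subst (_∈ bs) (sym x≡) x∈)) ∷ u
    unique-insert x (a ∷ as) bs (a∉ ∷ u) x∉ =
      All.tabulate (λ z∈ a≡z → [ (λ z≡x → x∉ (here (trans (sym z≡x) (sym a≡z)))) , (λ z∈′ → All.lookup a∉ z∈′ a≡z) ]′ (∈-insert⁻ as bs z∈))
      ∷ unique-insert x as bs u (x∉ ∘ there)

  unique-length-≤ : ∀ {xs ys : List A} → Unique xs → (∀ {v} → v ∈ xs → v ∈ ys) → length xs ≤ length ys
  unique-length-≤ {[]}     _          _   = z≤n
  unique-length-≤ {x ∷ xs} (x∉ ∷ u) xs⊆ with ∈-∃++ (xs⊆ (here refl))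
  ... | as , bs , refl = subst (suc (length xs) ≤_) (sym (length-++-sucʳ as x bs))
    (s≤s (unique-length-≤ u (λ v∈ → ∈-remove as bs (xs⊆ (there v∈)) (λ v≡x → All.lookup x∉ v∈ (sym v≡x)))))

  pigeonhole-unique : ∀ {us ws : List A} → Unique us → (∀ {v} → v ∈ us → v ∈ ws) → length ws ≤ length us → Unique ws
  pigeonhole-unique {[]}     {[]} _          _   _ = []
  pigeonhole-unique {x ∷ us} (x∉ ∷ u) us⊆ ws≤ with ∈-∃++ (us⊆ (here refl))
  ... | as , bs , refl = unique-insert x as bs (pigeonhole-unique u us⊆′ ≤us) x∉asbs
    where
    us⊆′ : ∀ {v} → v ∈ us → v ∈ as ++ bs
    us⊆′ v∈ = ∈-remove as bs (us⊆ (there v∈)) (λ v≡x → All.lookup x∉ v∈ (sym v≡x))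
    ≤us : length (as ++ bs) ≤ length us
    ≤us = ≤-pred (subst (_≤ suc (length us)) (length-++-sucʳ as x bs) ws≤)
    x∉asbs : x ∉ as ++ bs
    x∉asbs x∈ = contradiction (unique-length-≤ (x∉ ∷ u) (λ { (here refl) → x∈ ; (there v∈) → us⊆′ v∈ })) (<⇒≱ (s≤s ≤us))

module _ {A B : Set} (f : A → B) where

  unique-map-locally : ∀ {xs} → Unique xs → (∀ {x y} → x ∈ xs → y ∈ xs → f x ≡ f y → x ≡ y) → Unique (map f xs)
  unique-map-locally {[]}     []         _   = []
  unique-map-locally {x ∷ xs} (x∉ ∷ u) inj =
    All.map⁺ (All.tabulate λ y∈ fx≡fy → All.lookup x∉ y∈ (inj (here refl) (there y∈) fx≡fy))
    ∷ unique-map-locally u (λ x∈ y∈ → inj (there x∈) (there y∈))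

  length-≤-by-injection : ∀ {xs ys} → Unique xs → (∀ {x} → x ∈ xs → f x ∈ ys) →
    (∀ {x y} → x ∈ xs → y ∈ xs → f x ≡ f y → x ≡ y) → length xs ≤ length ys
  length-≤-by-injection {xs} {ys} u into inj =
    subst (_≤ length ys) (length-map f xs) (unique-length-≤ (unique-map-locally u inj) (into′ ∘ ∈-map⁻ f))
    where
    into′ : ∀ {v} → ∃ (λ x → x ∈ xs × v ≡ f x) → v ∈ ys
    into′ (x , x∈ , refl) = into x∈

module _ {A B C : Set} (f : A → B → C) where

  concatMap-map : ∀ xs ys → concatMap (λ x → map (f x) ys) xs ≡ cartesianProductWith f xs ys
  concatMap-map []       ys = refl
  concatMap-map (x ∷ xs) ys = cong (map (f x) ys ++_) (concatMap-map xs ys)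

  length-cartesianProductWith : ∀ xs ys → length (cartesianProductWith f xs ys) ≡ length xs * length ys
  length-cartesianProductWith []       ys = refl
  length-cartesianProductWith (x ∷ xs) ys = begin
    length (map (f x) ys ++ cartesianProductWith f xs ys)      ≡⟨ length-++ (map (f x) ys) ⟩
    length (map (f x) ys) + length (cartesianProductWith f xs ys) ≡⟨ cong₂ _+_ (length-map (f x) ys) (length-cartesianProductWith xs ys) ⟩
    length ys + length xs * length ys                          ∎
    where open ≡-Reasoning

module _ {A : Set} where

  tuples : List A → ℕ → List (List A)
  tuples xs zero    = [ [] ]
  tuples xs (suc n) = cartesianProductWith _∷_ xs (tuples xs n)

  ∈-tuples⁻ : ∀ xs n {w} → w ∈ tuples xs n → length w ≡ n × All (_∈ xs) w
  ∈-tuples⁻ xs zero    (here refl) = refl , []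
  ∈-tuples⁻ xs (suc n) w∈ with ∈-cartesianProductWith⁻ _∷_ xs (tuples xs n) w∈
  ... | x , w′ , x∈ , w′∈ , refl = let l , a = ∈-tuples⁻ xs n w′∈ in cong suc l , x∈ ∷ a

  ∈-tuples⁺ : ∀ xs {w} → All (_∈ xs) w → w ∈ tuples xs (length w)
  ∈-tuples⁺ xs []           = here refl
  ∈-tuples⁺ xs (x∈ ∷ w∈)    = ∈-cartesianProductWith⁺ _∷_ x∈ (∈-tuples⁺ xs w∈)

  tuples-unique : ∀ {xs} n → Unique xs → Unique (tuples xs n)
  tuples-unique zero    _ = [] ∷ []
  tuples-unique (suc n) u = Unique.cartesianProductWith⁺ _∷_ ∷-injective u (tuples-unique n u)

  length-tuples : ∀ xs n → length (tuples xs n) ≡ length xs ^ n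
  length-tuples xs zero    = refl
  length-tuples xs (suc n) = trans (length-cartesianProductWith _∷_ xs (tuples xs n)) (cong (length xs *_) (length-tuples xs n))

words≡tuples : ∀ xs n → words xs n ≡ tuples xs n
words≡tuples xs zero    = refl
words≡tuples xs (suc n) rewrite words≡tuples xs n = concatMap-map _∷_ xs (tuples xs n)

record Permutation (n : ℕ) (w : List ℕ) : Set where
  field
    length≡ : length w ≡ n
    inRange : All (InRange n) w
    onto    : ∀ {v} → InRange n v → v ∈ w

∈-S⁻ : ∀ {n w} → w ∈ S n → Permutation n w
∈-S⁻ {n} {w} w∈ with ∈-filter⁻ (T? ∘ isPerm n) {xs = words (range n) n} w∈
... | w∈words , isPerm-w with to T-∧ isPerm-w
... | length≡ᵇ , covers = record
  { length≡ = to T-≡ᵇ length≡ᵇ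
  ; inRange = All.map (to ∈-range) (proj₂ (∈-tuples⁻ (range n) n (subst (w ∈_) (words≡tuples (range n) n) w∈words)))
  ; onto    = onto
  }
  where
  onto : ∀ {v} → InRange n v → v ∈ w
  onto {suc v} (_ , v<n) = to T-elemᵇ (to (All-range n) (to (T-all _ (range n)) covers) v<n)

∈-S⁺ : ∀ {n w} → Permutation n w → w ∈ S n
∈-S⁺ {n} {w} p = ∈-filter⁺ (T? ∘ isPerm n) w∈words (from T-∧ (from T-≡ᵇ length≡ , covers))
  where
  open Permutation p
  w∈words : w ∈ words (range n) n
  w∈words = subst (w ∈_) (sym (words≡tuples (range n) n))
              (subst (λ l → w ∈ tuples (range n) l) length≡ (∈-tuples⁺ (range n) (All.map (from ∈-range) inRange)))
  covers : T (all (λ j → elemᵇ j w) (range n))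
  covers = from (T-all _ (range n)) (from (All-range n) (λ i<n → from T-elemᵇ (onto (s≤s z≤n , i<n))))

range-unique : ∀ n → Unique (range n)
range-unique n = AllPairs.map <⇒≢ (range-increasing n)

S-unique : ∀ n → Unique (S n)
S-unique n = Unique.filter⁺ (T? ∘ isPerm n) (subst Unique (sym (words≡tuples (range n) n)) (tuples-unique n (range-unique n)))

Permutation-unique : ∀ {n w} → Permutation n w → Unique w
Permutation-unique {n} p = pigeonhole-unique (range-unique n) (onto ∘ to ∈-range)
                             (≤-reflexive (trans length≡ (sym (length-applyUpTo suc n))))
  where open Permutation p

pos-inRange : ∀ {v} xs → v ∈ xs → InRange (length xs) (pos v xs)
pos-inRange {v} (x ∷ xs) v∈ with v ≡ᵇ x in v≡ᵇx
... | true = s≤s z≤n , s≤s z≤n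
pos-inRange {v} (x ∷ xs) (here refl) | false = ⊥-elim (subst T v≡ᵇx (≡⇒≡ᵇ v v refl))
pos-inRange {v} (x ∷ xs) (there v∈)  | false rewrite to T-≡ (from T-elemᵇ v∈) =
  s≤s z≤n , s≤s (proj₂ (pos-inRange xs v∈))

at-pos : ∀ {v} xs → v ∈ xs → at xs (pos v xs) ≡ v
at-pos {v} (x ∷ xs) v∈ with v ≡ᵇ x in v≡ᵇx
... | true = sym (≡ᵇ⇒≡ v x (subst T (sym v≡ᵇx) _))
at-pos {v} (x ∷ xs) (here refl) | false = ⊥-elim (subst T v≡ᵇx (≡⇒≡ᵇ v v refl))
at-pos {v} (x ∷ xs) (there v∈)  | false rewrite to T-≡ (from T-elemᵇ v∈)
  with pos v xs | pos-inRange xs v∈ | at-pos xs v∈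
... | suc p | _ | at≡v = at≡v

pos-at : ∀ xs → Unique xs → ∀ {i} → i < length xs → pos (at xs (suc i)) xs ≡ suc i
pos-at (x ∷ xs) _ {zero} _ rewrite to T-≡ (≡⇒≡ᵇ x x refl) = refl
pos-at (x ∷ xs) (x∉ ∷ u) {suc i} (s≤s i<n)
  rewrite to T-not-≡ (from T-not (All.lookup x∉ (at-∈ xs i<n) ∘ sym ∘ ≡ᵇ⇒≡ _ x))
        | to T-≡ (from T-elemᵇ (at-∈ xs i<n)) = cong suc (pos-at xs u i<n)

⊆-at⁻ : ∀ {ys xs} → ys ⊆ xs →
  ∃ λ P → AllPairs _<_ P × All (_< length xs) P × ys ≡ map (λ p → at xs (suc p)) P
⊆-at⁻ [] = [] , [] , [] , refl
⊆-at⁻ {xs = x ∷ xs} (.x ∷ʳ ys⊆) with ⊆-at⁻ ys⊆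
... | P , P↑ , P< , refl = map suc P , AllPairs.map⁺ (AllPairs.map s≤s P↑) , All.map⁺ (All.map s≤s P<) , map-∘ P
⊆-at⁻ {xs = x ∷ xs} (refl ∷ ys⊆) with ⊆-at⁻ ys⊆
... | P , P↑ , P< , refl =
  0 ∷ map suc P , All.map⁺ (All.universal (λ _ → s≤s z≤n) P) ∷ AllPairs.map⁺ (AllPairs.map s≤s P↑) ,
  s≤s z≤n ∷ All.map⁺ (All.map s≤s P<) , cong (x ∷_) (map-∘ P)

positive-view : ∀ {P} → All (0 <_) P → ∃ λ Q → P ≡ map suc Q
positive-view []                 = [] , refl
positive-view {suc p ∷ _} (_ ∷ ps) = let Q , P≡ = positive-view ps in p ∷ Q , cong (suc p ∷_) P≡

⊆-at⁺ : ∀ xs {P} → AllPairs _<_ P → All (_< length xs) P → map (λ p → at xs (suc p)) P ⊆ xs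
⊆-at⁺ xs       {[]}        _          _        = minimum xs
⊆-at⁺ []       {p ∷ P}     _          (() ∷ _)
⊆-at⁺ (x ∷ xs) {zero ∷ P}  (0<P ∷ P↑) (_ ∷ P<) with positive-view 0<P
... | Q , refl = refl ∷ subst (_⊆ xs) (map-∘ Q) (⊆-at⁺ xs (AllPairs.map s<s⁻¹ (AllPairs.map⁻ P↑)) (All.map s<s⁻¹ (All.map⁻ P<)))
⊆-at⁺ (x ∷ xs) {suc p ∷ P} P↑         P<       with positive-view (All.map (<-trans z<s) (AllPairs.head P↑))
... | Q , refl = x ∷ʳ subst (_⊆ xs) (map-∘ (p ∷ Q)) (⊆-at⁺ xs (AllPairs.map s<s⁻¹ (AllPairs.map⁻ P↑)) (All.map s<s⁻¹ (All.map⁻ P<)))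

⊆-by-positions : ∀ μ {vs} → All (_∈ μ) vs → AllPairs (λ v w → pos v μ < pos w μ) vs → vs ⊆ μ
⊆-by-positions μ {vs} vs∈ pos↑ with positive-view (All.map⁺ (All.map (proj₁ ∘ pos-inRange μ) vs∈))
... | Q , positions≡ = subst (_⊆ μ) values (⊆-at⁺ μ Q↑ Q<)
  where
  Q↑ : AllPairs _<_ Q
  Q↑ = AllPairs.map s<s⁻¹ (AllPairs.map⁻ (subst (AllPairs _<_) positions≡ (AllPairs.map⁺ pos↑)))
  Q< : All (_< length μ) Q
  Q< = All.map⁻ (subst (All (_≤ length μ)) positions≡ (All.map⁺ (All.map (proj₂ ∘ pos-inRange μ) vs∈)))
  values : map (λ q → at μ (suc q)) Q ≡ vs
  values = begin
    map (λ q → at μ (suc q)) Q       ≡⟨ map-∘ Q ⟩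
    map (at μ) (map suc Q)           ≡⟨ cong (map (at μ)) positions≡ ⟨
    map (at μ) (map (λ v → pos v μ) vs) ≡⟨ map-∘ vs ⟨
    map (λ v → at μ (pos v μ)) vs    ≡⟨ map-cong-local (All.map (at-pos μ) vs∈) ⟩
    map (λ v → v) vs                 ≡⟨ map-id vs ⟩
    vs                               ∎
    where open ≡-Reasoning

-- The complement of the inverse

mirror₁-inRange : ∀ {n p} → InRange n p → InRange n (suc n ∸ p)
mirror₁-inRange {n} {suc p} (_ , p≤n) = subst (1 ≤_) (sym (+-∸-assoc 1 p≤n)) (s≤s z≤n) , m∸n≤m n p

compInv : List ℕ → List ℕ
compInv μ = comp (inv μ)

length-inv : ∀ μ → length (inv μ) ≡ length μ
length-inv μ = trans (length-map _ (range (length μ))) (length-applyUpTo suc (length μ))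

length-compInv : ∀ μ → length (compInv μ) ≡ length μ
length-compInv μ = trans (length-map _ (inv μ)) (length-inv μ)

at-inv : ∀ μ {y} → y < length μ → at (inv μ) (suc y) ≡ pos (suc y) μ
at-inv μ {y} y<m =
  trans (at-map (λ j → pos j μ) (range (length μ)) (subst (y <_) (sym (length-applyUpTo suc (length μ))) y<m))
        (cong (λ j → pos j μ) (at-applyUpTo suc (length μ) y<m))

at-compInv : ∀ μ {y} → y < length μ → at (compInv μ) (suc y) ≡ suc (length μ) ∸ pos (suc y) μ
at-compInv μ {y} y<m =
  trans (at-map (λ v → suc (length (inv μ)) ∸ v) (inv μ) (subst (y <_) (sym (length-inv μ)) y<m))
        (cong₂ (λ l p → suc l ∸ p) (length-inv μ) (at-inv μ y<m))

at-comp-rev : ∀ μ {x} → x < length μ → at (comp (rev μ)) (suc x) ≡ suc (length μ) ∸ at μ (suc (length μ ∸ suc x))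
at-comp-rev μ {x} x<m =
  trans (at-map (λ v → suc (length (rev μ)) ∸ v) (rev μ) (subst (x <_) (sym (length-reverse μ)) x<m))
        (cong₂ (λ l v → suc l ∸ v) (length-reverse μ) (at-reverse μ x<m))

at-rot : ∀ μ {x} → x < length μ → at (rot μ) (suc x) ≡ pos (suc (length μ ∸ suc x)) μ
at-rot μ {x} x<m = begin
  at (reverse (inv μ)) (suc x)               ≡⟨ at-reverse (inv μ) (subst (x <_) (sym (length-inv μ)) x<m) ⟩
  at (inv μ) (suc (length (inv μ) ∸ suc x))  ≡⟨ cong (λ l → at (inv μ) (suc (l ∸ suc x))) (length-inv μ) ⟩
  at (inv μ) (suc (length μ ∸ suc x))        ≡⟨ at-inv μ (mirror-< x<m) ⟩
  pos (suc (length μ ∸ suc x)) μ             ∎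
  where open ≡-Reasoning

Reverses : ℕ → List ℕ → List ℕ → Set
Reverses m b′ b = ∀ {i} → i < m → at b′ (at b (suc i)) ≡ m ∸ i

reverses⇒nonIncreasing : ∀ {m} b′ b → length b ≡ m → Reverses m b′ b → AllPairs _≥_ (map (at b′) b)
reverses⇒nonIncreasing {m} b′ b b≡m rev = AllPairs-at⁺ (map (at b′) b) λ {i} {j} i<j j<n →
  let j<m = subst (j <_) (trans (length-map (at b′) b) b≡m) j<n in begin
    at (map (at b′) b) (suc j)  ≡⟨ at-map (at b′) b (subst (j <_) (sym b≡m) j<m) ⟩
    at b′ (at b (suc j))        ≡⟨ rev j<m ⟩
    m ∸ j                       ≤⟨ ∸-monoʳ-≤ m (<⇒≤ i<j) ⟩
    m ∸ i                       ≡⟨ rev (<-trans i<j j<m) ⟨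
    at b′ (at b (suc i))        ≡⟨ at-map (at b′) b (subst (i <_) (sym b≡m) (<-trans i<j j<m)) ⟨
    at (map (at b′) b) (suc i)  ∎
  where open ≤-Reasoning

module _ {m μ} (p : Permutation m μ) where
  open Permutation p

  private
    bound : ∀ {i} → i < m → i < length μ
    bound = subst (_ <_) (sym length≡)

  compInv-reverses : Reverses m (compInv μ) μ
  compInv-reverses {i} i<m with at μ (suc i) in μᵢ≡ | All.lookup inRange (at-∈ μ (bound i<m))
  ... | suc q | _ , q<m = begin
    at (compInv μ) (suc q)         ≡⟨ at-compInv μ (bound q<m) ⟩
    suc (length μ) ∸ pos (suc q) μ ≡⟨ cong₂ (λ l v → suc l ∸ pos v μ) length≡ (sym μᵢ≡) ⟩
    suc m ∸ pos (at μ (suc i)) μ   ≡⟨ cong (suc m ∸_) (pos-at μ (Permutation-unique p) (bound i<m)) ⟩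
    m ∸ i                          ∎
    where open ≡-Reasoning

  reverses-compInv : μ ≡ comp (rev μ) → Reverses m μ (compInv μ)
  reverses-compInv μ≡ {i} i<m with pos (suc i) μ in pos≡ | pos-inRange μ (onto (s≤s z≤n , i<m))
  ... | suc y | _ , y<L = begin
    at μ (at (compInv μ) (suc i))              ≡⟨ cong (at μ) (at-compInv μ (bound i<m)) ⟩
    at μ (suc (length μ) ∸ pos (suc i) μ)      ≡⟨ cong (λ v → at μ (suc (length μ) ∸ v)) pos≡ ⟩
    at μ (length μ ∸ y)                        ≡⟨ cong (at μ) (suc-mirror y<L) ⟨
    at μ (suc (length μ ∸ suc y))              ≡⟨ cong (λ ν → at ν (suc (length μ ∸ suc y))) μ≡ ⟩
    at (comp (rev μ)) (suc (length μ ∸ suc y)) ≡⟨ at-comp-rev μ (mirror-< y<L) ⟩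
    suc (length μ) ∸ at μ (suc (length μ ∸ suc (length μ ∸ suc y))) ≡⟨ cong (λ x → suc (length μ) ∸ at μ (suc x)) (mirror-involutive y<L) ⟩
    suc (length μ) ∸ at μ (suc y)              ≡⟨ cong₂ (λ l v → suc l ∸ at μ v) (sym length≡) pos≡ ⟨
    suc m ∸ at μ (pos (suc i) μ)               ≡⟨ cong (suc m ∸_) (at-pos μ (onto (s≤s z≤n , i<m))) ⟩
    m ∸ i                                      ∎
    where open ≡-Reasoning

  rot-fixed-reverses : μ ≡ rot μ → Reverses m μ μ
  rot-fixed-reverses μ≡ {i} i<m = begin
    at μ (at μ (suc i))                             ≡⟨ cong (λ ν → at μ (at ν (suc i))) μ≡ ⟩
    at μ (at (rot μ) (suc i))                       ≡⟨ cong (at μ) (at-rot μ (bound i<m)) ⟩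
    at μ (pos (suc (length μ ∸ suc i)) μ)           ≡⟨ at-pos μ (onto (s≤s z≤n , subst (length μ ∸ suc i <_) length≡ (mirror-< (bound i<m)))) ⟩
    suc (length μ ∸ suc i)                          ≡⟨ cong (λ l → suc (l ∸ suc i)) length≡ ⟩
    suc (m ∸ suc i)                                 ≡⟨ suc-mirror i<m ⟩
    m ∸ i                                           ∎
    where open ≡-Reasoning

  compInv-permutation : Permutation m (compInv μ)
  compInv-permutation = record
    { length≡ = trans (length-compInv μ) length≡
    ; inRange = subst (λ n → All (InRange n) (compInv μ)) length≡ entries
    ; onto    = onto′
    }
    where
    L≡ : length (compInv μ) ≡ m
    L≡ = trans (length-compInv μ) length≡
    entries : All (InRange (length μ)) (compInv μ)
    entries = All-at⁺ (compInv μ) λ {y} y<L′ →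
      let y<L = subst (y <_) (length-compInv μ) y<L′ in
      subst (InRange (length μ)) (sym (at-compInv μ y<L))
            (mirror₁-inRange (pos-inRange μ (onto (s≤s z≤n , subst (y <_) length≡ y<L))))
    onto′ : ∀ {v} → InRange m v → v ∈ compInv μ
    onto′ {v} (1≤v , v≤m) = subst (_∈ compInv μ) value (at-∈₁ (compInv μ) (subst (λ n → InRange n (at μ (suc (m ∸ v)))) (sym L≡) (All.lookup inRange (at-∈ μ (bound x<m)))))
      where
      x<m : m ∸ v < m
      x<m = ∸-monoʳ-< 1≤v v≤m
      value : at (compInv μ) (at μ (suc (m ∸ v))) ≡ v
      value = trans (compInv-reverses x<m) (m∸[m∸n]≡n v≤m)

  -- An increasing run of compInv μ at positions P puts the values 1+P at decreasing positions of μ.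
  compInv-avoids : ∀ {r} → ¬ HasChain _>_ r μ → ¬ HasChain _<_ r (compInv μ)
  compInv-avoids noDecreasing (ys , ys⊆ , ys≡r , ys↑) with ⊆-at⁻ ys⊆
  ... | P , P↑ , P<′ , refl = noDecreasing
    ( reverse (map suc P)
    , ⊆-by-positions μ (All-reverse (All.map⁺ (All.map (λ i<L → onto (s≤s z≤n , subst (_ <_) length≡ i<L)) P<)))
                       (AllPairs-reverse (AllPairs.map⁺ positions↓))
    , trans (length-reverse (map suc P)) (trans (length-map suc P) (trans (sym (length-map _ P)) ys≡r))
    , AllPairs-reverse (AllPairs.map⁺ (AllPairs.map s≤s P↑)) )
    where
    P< : All (_< length μ) P
    P< = subst (λ n → All (_< n) P) (length-compInv μ) P<′
    positions↓ : AllPairs (λ i j → pos (suc j) μ < pos (suc i) μ) P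
    positions↓ = AllPairs.map ∸-cancelʳ-< (AllPairs.map⁻ (subst (AllPairs _<_) (map-cong-local (All.map (at-compInv μ) P<)) ys↑))

-- Skew sums of blocks

shiftBlocks : ℕ → List (List ℕ) → List (List ℕ)
shiftBlocks m []       = []
shiftBlocks m (b ∷ bs) = map (_+ length bs * m) b ∷ shiftBlocks m bs

skewSum : ℕ → List (List ℕ) → List ℕ
skewSum m bs = concat (shiftBlocks m bs)

skewSum-permutation : ∀ {m} bs → All (Permutation m) bs → Permutation (length bs * m) (skewSum m bs)
skewSum-permutation []       [] = record { length≡ = refl ; inRange = [] ; onto = λ (1≤v , v≤0) → contradiction (≤-trans 1≤v v≤0) λ () }
skewSum-permutation {m} (b ∷ bs) (p ∷ ps) = record
  { length≡ = trans (length-++ (map (_+ c) b)) (cong₂ _+_ (trans (length-map (_+ c) b) length≡) (Permutation.length≡ rest))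
  ; inRange = All.++⁺ (All.map⁺ (All.map shifted inRange)) (All.map (λ (1≤v , v≤c) → 1≤v , ≤-trans v≤c (m≤n+m c m)) (Permutation.inRange rest))
  ; onto    = onto′
  }
  where
  open Permutation p
  c : ℕ
  c = length bs * m
  rest : Permutation (length bs * m) (skewSum m bs)
  rest = skewSum-permutation bs ps
  shifted : ∀ {u} → InRange m u → InRange (m + c) (u + c)
  shifted {u} (1≤u , u≤m) = ≤-trans 1≤u (m≤m+n u c) , +-monoˡ-≤ c u≤m
  onto′ : ∀ {v} → InRange (m + c) v → v ∈ skewSum m (b ∷ bs)
  onto′ {v} (1≤v , v≤m+c) with v ≤? c
  ... | yes v≤c = ∈-++⁺ʳ (map (_+ c) b) (Permutation.onto rest (1≤v , v≤c))
  ... | no  v≰c = ∈-++⁺ˡ (subst (_∈ map (_+ c) b) (m∸n+n≡m (<⇒≤ c<v)) (∈-map⁺ (_+ c) (onto (m<n⇒0<n∸m c<v , v∸c≤m))))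
    where
    c<v : c < v
    c<v = ≰⇒> v≰c
    v∸c≤m : v ∸ c ≤ m
    v∸c≤m = subst (v ∸ c ≤_) (m+n∸n≡m m c) (∸-monoˡ-≤ c v≤m+c)

skewSum-avoids : ∀ {m r} bs → All (Permutation m) bs → All (λ b → ¬ HasChain _<_ (suc r) b) bs →
  ¬ HasChain _<_ (suc r) (skewSum m bs)
skewSum-avoids []       []       []            ([] , [] , () , _)
skewSum-avoids {m} {r} (b ∷ bs) (p ∷ ps) (noChain ∷ h) chain
  with chain-++ c (map (_+ c) b) (skewSum m bs) (suc r) above below chain
  where
  c : ℕ
  c = length bs * m
  above : All (c <_) (map (_+ c) b)
  above = All.map⁺ (All.map (λ (1≤u , _) → +-monoˡ-≤ c 1≤u) (Permutation.inRange p))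
  below : All (_≤ c) (skewSum m bs)
  below = All.map proj₂ (Permutation.inRange (skewSum-permutation bs ps))
... | inj₁ chain₁ = noChain (chain-shift (length bs * m) b (suc r) chain₁)
... | inj₂ chain₂ = skewSum-avoids bs ps h chain₂

block : List (List ℕ) → ℕ → List ℕ
block []       _       = []
block (b ∷ bs) zero    = b
block (b ∷ bs) (suc t) = block bs t

All-block : ∀ {P : List ℕ → Set} {bs} → All P bs → ∀ {t} → t < length bs → P (block bs t)
All-block (p ∷ _)  {zero}  _         = p
All-block (_ ∷ ps) {suc t} (s≤s t<L) = All-block ps t<L

All-block⁺ : ∀ {P : List ℕ → Set} bs → (∀ {t} → t < length bs → P (block bs t)) → All P bs
All-block⁺ []       _ = []
All-block⁺ (b ∷ bs) h = h z<s ∷ All-block⁺ bs (h ∘ s≤s)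

length-shiftBlocks : ∀ m bs → length (shiftBlocks m bs) ≡ length bs
length-shiftBlocks m []       = refl
length-shiftBlocks m (b ∷ bs) = cong suc (length-shiftBlocks m bs)

block-shiftBlocks : ∀ m bs {t} → t < length bs → block (shiftBlocks m bs) t ≡ map (_+ (length bs ∸ suc t) * m) (block bs t)
block-shiftBlocks m (b ∷ bs) {zero}  _         = refl
block-shiftBlocks m (b ∷ bs) {suc t} (s≤s t<L) = block-shiftBlocks m bs t<L

at-skewSum : ∀ {m} bs → All (λ b → length b ≡ m) bs → ∀ {t u} → t < length bs → u < m →
  at (skewSum m bs) (suc (t * m + u)) ≡ at (block bs t) (suc u) + (length bs ∸ suc t) * m
at-skewSum {m} (b ∷ bs) (b≡m ∷ _) {zero} {u} _ u<m =
  trans (at-++ˡ (map (_+ length bs * m) b) _ (subst (u <_) (sym (trans (length-map _ b) b≡m)) u<m))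
        (at-map (_+ length bs * m) b (subst (u <_) (sym b≡m) u<m))
at-skewSum {m} (b ∷ bs) (b≡m ∷ bs≡m) {suc t} {u} (s≤s t<L) u<m = begin
  at (top ++ skewSum m bs) (suc (m + t * m + u))                ≡⟨ cong (at (top ++ skewSum m bs) ∘ suc) position ⟩
  at (top ++ skewSum m bs) (suc (length top + (t * m + u)))     ≡⟨ at-++ʳ top (skewSum m bs) (t * m + u) ⟩
  at (skewSum m bs) (suc (t * m + u))                          ≡⟨ at-skewSum bs bs≡m t<L u<m ⟩
  at (block bs t) (suc u) + (length bs ∸ suc t) * m            ∎
  where
  open ≡-Reasoning
  top : List ℕ
  top = map (_+ length bs * m) b
  position : m + t * m + u ≡ length top + (t * m + u)
  position = trans (+-assoc m (t * m) u) (cong (_+ (t * m + u)) (sym (trans (length-map _ b) b≡m)))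

MirrorCompatible : List (List ℕ) → Set
MirrorCompatible bs = ∀ {t} → t < length bs → AllPairs _≥_ (map (at (block bs (length bs ∸ suc t))) (block bs t))

module _ {m} bs (ps : All (Permutation m) bs) (compatible : MirrorCompatible bs) where

  private
    L : ℕ
    L = length bs
    π : List ℕ
    π = skewSum m bs

    at-skewSum-mirror : ∀ {t} → t < L → ∀ {u} → InRange m u →
      at π (u + (L ∸ suc t) * m) ≡ at (block bs (L ∸ suc t)) u + t * m
    at-skewSum-mirror {t} t<L {suc u} (_ , u<m) = begin
      at π (suc u + (L ∸ suc t) * m)                ≡⟨ cong (at π ∘ suc) (+-comm u _) ⟩
      at π (suc ((L ∸ suc t) * m + u))              ≡⟨ at-skewSum bs (All.map Permutation.length≡ ps) (mirror-< t<L) u<m ⟩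
      at (block bs (L ∸ suc t)) (suc u) + (L ∸ suc (L ∸ suc t)) * m ≡⟨ cong (λ s → at (block bs (L ∸ suc t)) (suc u) + s * m) (mirror-involutive t<L) ⟩
      at (block bs (L ∸ suc t)) (suc u) + t * m     ∎
      where open ≡-Reasoning

    run-nonIncreasing : ∀ {t} → t < L → AllPairs _≥_ (map (at π) (map (_+ (L ∸ suc t) * m) (block bs t)))
    run-nonIncreasing {t} t<L =
      subst (AllPairs _≥_) (sym run≡) (AllPairs.map⁺ (AllPairs.map (+-monoˡ-≤ (t * m)) (compatible t<L)))
      where
      run≡ : map (at π) (map (_+ (L ∸ suc t) * m) (block bs t)) ≡ map (_+ t * m) (map (at (block bs (L ∸ suc t))) (block bs t))
      run≡ = trans (sym (map-∘ (block bs t)))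
             (trans (map-cong-local (All.map (at-skewSum-mirror t<L) (Permutation.inRange (All-block ps t<L))))
                    (map-∘ (block bs t)))

  square-skewSum-runs : All (AllPairs _≥_) (map (map (at π)) (shiftBlocks m bs))
  square-skewSum-runs = All.map⁺ (All-block⁺ (shiftBlocks m bs) λ {t} t<L′ →
    let t<L = subst (t <_) (length-shiftBlocks m bs) t<L′ in
    subst (AllPairs _≥_ ∘ map (at π)) (sym (block-shiftBlocks m bs t<L)) (run-nonIncreasing t<L))

  square-skewSum-avoids : ¬ HasChain _<_ (suc L) (square π)
  square-skewSum-avoids (ys , ys⊆ , ys≡ , ys↑) = <-irrefl refl (subst (_≤ L) ys≡ (subst (length ys ≤_) runs≡L
    (increasing-in-runs _ square-skewSum-runs (subst (ys ⊆_) (sym (concat-map (shiftBlocks m bs))) ys⊆) ys↑)))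
    where
    runs≡L : length (map (map (at π)) (shiftBlocks m bs)) ≡ L
    runs≡L = trans (length-map _ (shiftBlocks m bs)) (length-shiftBlocks m bs)

-- Palindromic arrangements of blocks

palindrome : List (List ℕ) → List (List ℕ) → List (List ℕ)
palindrome []       mid = mid
palindrome (μ ∷ μs) mid = μ ∷ (palindrome μs mid ++ [ compInv μ ])

length-∷ʳ : ∀ {A : Set} (xs : List A) y → length (xs ++ [ y ]) ≡ suc (length xs)
length-∷ʳ xs y = trans (length-++-sucʳ xs y []) (cong (suc ∘ length) (++-identityʳ xs))

length-palindrome : ∀ μs mid → length (palindrome μs mid) ≡ 2 * length μs + length mid
length-palindrome []       mid = refl
length-palindrome (μ ∷ μs) mid = begin
  suc (length (palindrome μs mid ++ [ compInv μ ])) ≡⟨ cong suc (length-∷ʳ (palindrome μs mid) (compInv μ)) ⟩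
  suc (suc (length (palindrome μs mid)))            ≡⟨ cong (suc ∘ suc) (length-palindrome μs mid) ⟩
  suc (suc (2 * length μs + length mid))            ≡⟨ cong (_+ length mid) (*-suc 2 (length μs)) ⟨
  2 * suc (length μs) + length mid                  ∎
  where open ≡-Reasoning

All-palindrome : ∀ {P : List ℕ → Set} μs mid → All P μs → All (P ∘ compInv) μs → All P mid → All P (palindrome μs mid)
All-palindrome []       mid []       []         pmid = pmid
All-palindrome (μ ∷ μs) mid (p ∷ ps) (p′ ∷ ps′) pmid = p ∷ All.++⁺ (All-palindrome μs mid ps ps′ pmid) (p′ ∷ [])

palindrome-injective : ∀ μs μs′ mid mid′ → length μs ≡ length μs′ → palindrome μs mid ≡ palindrome μs′ mid′ →
  μs ≡ μs′ × mid ≡ mid′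
palindrome-injective []       []         mid mid′ _ eq = refl , eq
palindrome-injective (μ ∷ μs) (μ′ ∷ μs′) mid mid′ l eq with ∷-injective eq
... | refl , eq′ with palindrome-injective μs μs′ mid mid′ (suc-injective l) (proj₁ (∷ʳ-injective _ _ eq′))
... | refl , refl = refl , refl

block-++ˡ : ∀ xs ys {t} → t < length xs → block (xs ++ ys) t ≡ block xs t
block-++ˡ (x ∷ xs) ys {zero}  _         = refl
block-++ˡ (x ∷ xs) ys {suc t} (s≤s t<n) = block-++ˡ xs ys t<n

block-last : ∀ xs y → block (xs ++ [ y ]) (length xs) ≡ y
block-last []       y = refl
block-last (x ∷ xs) y = block-last xs y

mirrorCompatible-[] : MirrorCompatible []
mirrorCompatible-[] ()

mirrorCompatible-[_] : ∀ {c} → AllPairs _≥_ (map (at c) c) → MirrorCompatible [ c ]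
mirrorCompatible-[ c∘c ] {zero} _ = c∘c
mirrorCompatible-[ c∘c ] {suc t} (s≤s ())

mirrorCompatible-wrap : ∀ {b b′ xs} → AllPairs _≥_ (map (at b′) b) → AllPairs _≥_ (map (at b) b′) →
  MirrorCompatible xs → MirrorCompatible (b ∷ (xs ++ [ b′ ]))
mirrorCompatible-wrap {b} {b′} {xs} b′∘b b∘b′ compatible {t} t<L
  rewrite length-∷ʳ xs b′ with t
... | zero = subst (λ c → AllPairs _≥_ (map (at c) b)) (sym (block-last xs b′)) b′∘b
... | suc t with <-cmp t (length xs) | t<L
...   | tri< t<n _ _ | _ rewrite +-∸-assoc 1 t<n | block-++ˡ xs [ b′ ] t<n | block-++ˡ xs [ b′ ] (mirror-< t<n) = compatible t<n
...   | tri≈ _ refl _ | _ rewrite n∸n≡0 t | block-last xs b′ = b∘b′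
...   | tri> _ _ n<t | s≤s (s≤s t≤n) = contradiction t≤n (<⇒≱ n<t)

palindrome-mirrorCompatible : ∀ μs mid → All (λ μ → AllPairs _≥_ (map (at (compInv μ)) μ) × AllPairs _≥_ (map (at μ) (compInv μ))) μs →
  MirrorCompatible mid → MirrorCompatible (palindrome μs mid)
palindrome-mirrorCompatible []       mid []                     compatible = compatible
palindrome-mirrorCompatible (μ ∷ μs) mid ((ν∘μ , μ∘ν) ∷ h) compatible =
  mirrorCompatible-wrap ν∘μ μ∘ν (palindrome-mirrorCompatible μs mid h compatible)

++-injective : ∀ {A : Set} (xs xs′ : List A) {ys ys′} → length xs ≡ length xs′ → xs ++ ys ≡ xs′ ++ ys′ →
  xs ≡ xs′ × ys ≡ ys′
++-injective []       []         _ eq = refl , eq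
++-injective (x ∷ xs) (x′ ∷ xs′) l eq with ∷-injective eq
... | refl , eq′ with ++-injective xs xs′ (suc-injective l) eq′
... | refl , refl = refl , refl

skewSum-injective : ∀ {m} bs bs′ → All (λ b → length b ≡ m) bs → All (λ b → length b ≡ m) bs′ →
  length bs ≡ length bs′ → skewSum m bs ≡ skewSum m bs′ → bs ≡ bs′
skewSum-injective []       []         _          _            _ _  = refl
skewSum-injective {m} (b ∷ bs) (b′ ∷ bs′) (b≡m ∷ ps) (b′≡m ∷ ps′) l eq
  with ++-injective (map (_+ length bs * m) b) (map (_+ length bs′ * m) b′) lengths eq
  where
  lengths : length (map (_+ length bs * m) b) ≡ length (map (_+ length bs′ * m) b′)
  lengths = trans (length-map _ b) (trans b≡m (sym (trans (length-map _ b′) b′≡m)))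
... | tops≡ , rests≡ rewrite suc-injective l =
  cong₂ _∷_ (map-injective (+-cancelʳ-≡ _ _ _) tops≡) (skewSum-injective bs bs′ ps ps′ (suc-injective l) rests≡)

Admissible : ℕ → List ℕ → Set
Admissible k b = Permutation (k * k) b × ¬ HasChain _<_ (suc k) b

skewSum-∈-SAv : ∀ k bs → length bs ≡ k → All (Admissible k) bs → MirrorCompatible bs →
  skewSum (k * k) bs ∈ SAv (k * k * k) (incr (suc k))
skewSum-∈-SAv k bs bs≡k admissible compatible =
  ∈-filter⁺ _ (∈-S⁺ (subst (λ n → Permutation n π) size (skewSum-permutation bs perms)))
    (from T-∧ ( avoids-incr⁺ π (suc k) (skewSum-avoids bs perms (All.map proj₂ admissible))
              , avoids-incr⁺ (square π) (suc k) (subst (λ n → ¬ HasChain _<_ (suc n) (square π)) bs≡k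
                                                       (square-skewSum-avoids bs perms compatible))))
  where
  π : List ℕ
  π = skewSum (k * k) bs
  perms : All (Permutation (k * k)) bs
  perms = All.map proj₁ admissible
  size : length bs * (k * k) ≡ k * k * k
  size = trans (cong (_* (k * k)) bs≡k) (sym (*-assoc k k k))

compRevInvariant : ℕ → List (List ℕ)
compRevInvariant k = filterᵇ (λ μ → avoidsᵇ μ (incr (suc k)) ∧ avoidsᵇ μ (decr (suc k)) ∧ (μ ≡ʷ comp (rev μ))) (S (k * k))

rotInvariant : ℕ → List (List ℕ)
rotInvariant k = filterᵇ (λ μ → avoidsᵇ μ (incr (suc k)) ∧ avoidsᵇ μ (decr (suc k)) ∧ (μ ≡ʷ rot μ)) (S (k * k))

record OuterBlock (k : ℕ) (μ : List ℕ) : Set where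
  field
    admissible         : Admissible k μ
    compInv-admissible : Admissible k (compInv μ)
    compInv∘μ          : AllPairs _≥_ (map (at (compInv μ)) μ)
    μ∘compInv          : AllPairs _≥_ (map (at μ) (compInv μ))

∈-compRevInvariant : ∀ k {μ} → μ ∈ compRevInvariant k → OuterBlock k μ
∈-compRevInvariant k {μ} μ∈ with ∈-filter⁻ _ {xs = S (k * k)} μ∈
... | μ∈S , h with to T-∧ h
... | avoids↑ , h′ with to T-∧ h′
... | avoids↓ , symmetric = record
  { admissible         = p , avoids-incr⁻ μ (suc k) avoids↑
  ; compInv-admissible = compInv-permutation p , compInv-avoids p (avoids-decr⁻ μ (suc k) avoids↓)
  ; compInv∘μ          = reverses⇒nonIncreasing (compInv μ) μ (Permutation.length≡ p) (compInv-reverses p)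
  ; μ∘compInv          = reverses⇒nonIncreasing μ (compInv μ) (Permutation.length≡ (compInv-permutation p))
                           (reverses-compInv p (≡ʷ⇒≡ μ _ symmetric))
  }
  where
  p : Permutation (k * k) μ
  p = ∈-S⁻ μ∈S

∈-rotInvariant : ∀ k {c} → c ∈ rotInvariant k → Admissible k c × AllPairs _≥_ (map (at c) c)
∈-rotInvariant k {c} c∈ with ∈-filter⁻ _ {xs = S (k * k)} c∈
... | c∈S , h with to T-∧ h
... | avoids↑ , h′ =
  (p , avoids-incr⁻ c (suc k) avoids↑) ,
  reverses⇒nonIncreasing c c (Permutation.length≡ p) (rot-fixed-reverses p (≡ʷ⇒≡ c _ (proj₂ (to T-∧ h′))))
  where
  p : Permutation (k * k) c
  p = ∈-S⁻ c∈S

module _ (k j : ℕ) (mids : List (List (List ℕ))) (unique-mids : Unique mids)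
         (valid-mid : ∀ {mid} → mid ∈ mids → 2 * j + length mid ≡ k × All (Admissible k) mid × MirrorCompatible mid) where

  private
    Choice : Set
    Choice = List (List ℕ) × List (List ℕ)

    choices : List Choice
    choices = cartesianProduct (tuples (compRevInvariant k) j) mids

    arrange : Choice → List (List ℕ)
    arrange (μs , mid) = palindrome μs mid

    arrange-valid : ∀ {c} → c ∈ choices →
      length (arrange c) ≡ k × All (Admissible k) (arrange c) × MirrorCompatible (arrange c)
    arrange-valid {μs , mid} c∈ with ∈-cartesianProduct⁻ (tuples (compRevInvariant k) j) mids c∈
    ... | μs∈ , mid∈ with ∈-tuples⁻ (compRevInvariant k) j μs∈ | valid-mid mid∈
    ... | μs≡j , μs∈A | mid-length , mid-admissible , mid-compatible =
      trans (length-palindrome μs mid) (trans (cong (λ n → 2 * n + length mid) μs≡j) mid-length) ,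
      All-palindrome μs mid (All.map (OuterBlock.admissible ∘ ∈-compRevInvariant k) μs∈A)
                            (All.map (OuterBlock.compInv-admissible ∘ ∈-compRevInvariant k) μs∈A) mid-admissible ,
      palindrome-mirrorCompatible μs mid
        (All.map (λ μ∈ → let b = ∈-compRevInvariant k μ∈ in OuterBlock.compInv∘μ b , OuterBlock.μ∘compInv b) μs∈A) mid-compatible

    arrange-injective : ∀ {c c′} → c ∈ choices → c′ ∈ choices →
      skewSum (k * k) (arrange c) ≡ skewSum (k * k) (arrange c′) → c ≡ c′
    arrange-injective {μs , mid} {μs′ , mid′} c∈ c′∈ eq
      with arrange-valid c∈ | arrange-valid c′∈
    ... | l , adm , _ | l′ , adm′ , _
      with skewSum-injective (arrange (μs , mid)) (arrange (μs′ , mid′))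
             (All.map (Permutation.length≡ ∘ proj₁) adm) (All.map (Permutation.length≡ ∘ proj₁) adm′) (trans l (sym l′)) eq
    ... | pal≡ with palindrome-injective μs μs′ mid mid′ (trans (tuple-length c∈) (sym (tuple-length c′∈))) pal≡
      where
      tuple-length : ∀ {c} → c ∈ choices → length (proj₁ c) ≡ j
      tuple-length c∈ = proj₁ (∈-tuples⁻ (compRevInvariant k) j (proj₁ (∈-cartesianProduct⁻ _ mids c∈)))
    ... | refl , refl = refl

  skewPalindromes-count : a k ^ j * length mids ≤ length (SAv (k * k * k) (incr (suc k)))
  skewPalindromes-count = begin
    a k ^ j * length mids                                  ≡⟨ cong (_* length mids) (length-tuples (compRevInvariant k) j) ⟨
    length (tuples (compRevInvariant k) j) * length mids   ≡⟨ length-cartesianProductWith _,_ (tuples (compRevInvariant k) j) mids ⟨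
    length choices                                         ≤⟨ length-≤-by-injection (skewSum (k * k) ∘ arrange) unique-choices into arrange-injective ⟩
    length (SAv (k * k * k) (incr (suc k)))                ∎
    where
    open ≤-Reasoning
    unique-choices : Unique choices
    unique-choices = Unique.cartesianProduct⁺ (tuples-unique j (Unique.filter⁺ _ (S-unique (k * k)))) unique-mids
    into : ∀ {c} → c ∈ choices → skewSum (k * k) (arrange c) ∈ SAv (k * k * k) (incr (suc k))
    into c∈ = let l , adm , compatible = arrange-valid c∈ in skewSum-∈-SAv k _ l adm compatible

lemma3p1 : (k : ℕ) → 1 ≤ k →
    ((j : ℕ) → k ≡ 2 * j → a k ^ j ≤ length (SAv (k * k * k) (incr (suc k))))
    × ((j : ℕ) → k ≡ 2 * j + 1 → a k ^ j * a′ k ≤ length (SAv (k * k * k) (incr (suc k))))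
lemma3p1 k _ = even , odd
  where
  even : (j : ℕ) → k ≡ 2 * j → a k ^ j ≤ length (SAv (k * k * k) (incr (suc k)))
  even j k≡2j = subst (_≤ length (SAv (k * k * k) (incr (suc k)))) (*-identityʳ (a k ^ j))
    (skewPalindromes-count k j [ [] ] ([] ∷ [])
      λ { (here refl) → trans (+-identityʳ (2 * j)) (sym k≡2j) , [] , mirrorCompatible-[] })
  odd : (j : ℕ) → k ≡ 2 * j + 1 → a k ^ j * a′ k ≤ length (SAv (k * k * k) (incr (suc k)))
  odd j k≡2j+1 = subst (λ n → a k ^ j * n ≤ length (SAv (k * k * k) (incr (suc k)))) (length-map [_] (rotInvariant k))
    (skewPalindromes-count k j (map [_] (rotInvariant k))
      (unique-map-locally [_] (Unique.filter⁺ _ (S-unique (k * k))) (λ _ _ → proj₁ ∘ ∷-injective))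
      middle)
    where
    middle : ∀ {mid} → mid ∈ map [_] (rotInvariant k) → 2 * j + length mid ≡ k × All (Admissible k) mid × MirrorCompatible mid
    middle mid∈ with ∈-map⁻ [_] mid∈
    ... | c , c∈ , refl = let admissible , c∘c = ∈-rotInvariant k c∈ in sym k≡2j+1 , admissible ∷ [] , mirrorCompatible-[ c∘c ]
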